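{- Let $G$ be a connected graph of order $n \ge 5$ that contains a Hamiltonian path and satisfies $|E(G)| \ge 2(n-2)$. Then $\dim(L(G)) \le Z(L(G))$.
   Context: All graphs are finite, simple and undirected. $L(G)$ is the line graph of $G$. For a graph $H$, $W \subseteq V(H)$ is a resolving set if for every pair of distinct vertices $u,v$ some $x \in W$ has $d(u,x) \ne d(v,x)$ ($d$ the shortest-path distance); $\dim(H)$ is the minimum size of a resolving set. Zero forcing: each vertex is colored black or white; if a black vertex $u$ has exactly one white neighbor $w$, then $w$ becomes black. $S \subseteq V(H)$ is a zero forcing set if starting with exactly $S$ black, repeated application of this rule makes all vertices black; $Z(H)$ is the minimum size of a zero forcing set. -}

module Defs where

open import Data.Nat using (ℕ; zero; suc; _<_; _≤_)
open import Data.Fin using (Fin; toℕ; _≟_)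
open import Data.Fin.Subset using (Subset; _∈_; ∣_∣)
open import Data.Bool using (Bool; true; false; _∧_; _∨_; if_then_else_)
open import Data.List using (List; []; _∷_; upTo; allFin)
open import Data.Bool.ListAction using (any)
open import Data.Maybe using (Maybe; just; nothing)
open import Data.Vec using (Vec; lookup; replicate; _[_]≔_)
open import Data.Product using (Σ; ∃; ∃-syntax; _×_; _,_)
open import Relation.Binary.PropositionalEquality using (_≡_; _≢_)
open import Relation.Nullary.Decidable using (isYes)
open import Relation.Binary.Construct.Closure.ReflexiveTransitive using (Star)
open import Data.Sum using (_⊎_)
open import Function.Definitions using (Injective)
open import Function.Bundles using (_↔_; Inverse)

record Graph (n : ℕ) : Set where
  field
    adj    : Fin n → Fin n → Bool
    sym    : ∀ u v → adj u v ≡ adj v u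
    irrefl : ∀ u → adj u u ≡ false

open Graph public

Adj : ∀ {n} → Graph n → Fin n → Fin n → Set
Adj G u v = adj G u v ≡ true

data Reach {n : ℕ} (G : Graph n) : Fin n → Fin n → Set where
  here : ∀ {u} → Reach G u u
  step : ∀ {u v w} → Reach G u v → Adj G v w → Reach G u w

Connected : ∀ {n} → Graph n → Set
Connected {n} G = ∀ (u v : Fin n) → Reach G u v

-- a Hamiltonian path: an ordering p(0),…,p(n-1) of all vertices (p injective,
-- hence a bijection of Fin n) with consecutive vertices adjacent
HasHamiltonianPath : ∀ {n} → Graph n → Set
HasHamiltonianPath {n} G =
  Σ (Fin n → Fin n) λ p → Injective _≡_ _≡_ p ×
    (∀ (i j : Fin n) → toℕ j ≡ suc (toℕ i) → Adj G (p i) (p j))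

-- edges of G: unordered pairs {u,v} represented as (u,v) with u < v
Edge : ∀ {n} → Graph n → Set
Edge {n} G = Σ (Fin n × Fin n) λ { (u , v) → (toℕ u < toℕ v) × Adj G u v }

-- two distinct edges are adjacent in L(G) iff they share an endpoint
ShareEndpoint : ∀ {n} {G : Graph n} → Edge G → Edge G → Set
ShareEndpoint ((a , b) , _) ((c , d) , _) = (a ≡ c) ⊎ (a ≡ d) ⊎ (b ≡ c) ⊎ (b ≡ d)

-- H (on vertex set Fin m) is the line graph L(G), via an enumeration
-- e : Fin m ↔ Edge G of the edges of G.  In particular m = |E(G)|.
record IsLineGraph {n m : ℕ} (G : Graph n) (H : Graph m) : Set where
  field
    enum   : Fin m ↔ Edge G
  open Inverse enum public
  field
    adjOK  : ∀ (i j : Fin m) → (Adj H i j → (i ≢ j) × ShareEndpoint {G = G} (to i) (to j))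
                              × ((i ≢ j) × ShareEndpoint {G = G} (to i) (to j) → Adj H i j)

-- Shortest-path distance (nothing = ∞, i.e. no walk)

within : ∀ {m} → Graph m → ℕ → Fin m → Fin m → Bool
within H zero    u v = isYes (u ≟ v)
within {m} H (suc k) u v = within H k u v ∨ any (λ w → within H k u w ∧ adj H w v) (allFin m)

firstTrue : (ℕ → Bool) → List ℕ → Maybe ℕ
firstTrue f []       = nothing
firstTrue f (k ∷ ks) = if f k then just k else firstTrue f ks

-- d(u,v): least k (a shortest path has length < m) with a walk of length ≤ k
dist : ∀ {m} → Graph m → Fin m → Fin m → Maybe ℕ
dist {m} H u v = firstTrue (λ k → within H k u v) (upTo (suc m))

Resolving : ∀ {m} → Graph m → Subset m → Set
Resolving {m} H W = ∀ (u v : Fin m) → u ≢ v → ∃[ x ] (x ∈ W × dist H u x ≢ dist H v x)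

IsMetricDimension : ∀ {m} → Graph m → ℕ → Set
IsMetricDimension {m} H d =
  (∃[ W ] (Resolving H W × ∣ W ∣ ≡ d)) × (∀ W → Resolving H W → d ≤ ∣ W ∣)

-- Zero forcing (a coloring is a Subset: true = black)

ForceStep : ∀ {m} → Graph m → Subset m → Subset m → Set
ForceStep {m} H c c' =
  ∃[ u ] ∃[ w ] (u ∈ c × Adj H u w × lookup c w ≡ false
    × (∀ w' → Adj H u w' → w' ≢ w → w' ∈ c)
    × c' ≡ (c [ w ]≔ true))

ZeroForcingSet : ∀ {m} → Graph m → Subset m → Set
ZeroForcingSet {m} H S = Star (ForceStep H) S (replicate m true)

IsZeroForcingNumber : ∀ {m} → Graph m → ℕ → Set
IsZeroForcingNumber {m} H z =
  (∃[ S ] (ZeroForcingSet H S × ∣ S ∣ ≡ z)) × (∀ S → ZeroForcingSet H S → z ≤ ∣ S ∣)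

module Submission where

-- Number the vertices of G along the Hamiltonian path, so that an edge of G, i.e. a vertex of L(G),
-- becomes a pair {i, j} of positions.
--
-- dim(L(G)) ≤ n − 2: let W consist of the path edges {k, k+1} with k ≤ n − 3. Two vertices of L(G) are at
-- distance 1 exactly when they share an endpoint, so it suffices that a pair {i, j} outside W is determined by
-- the members of W it meets; it is, except that for n = 5 the pairs {0,2} and {1,3} meet the same ones, and
-- then (if {1,3} is an edge) W = {{0,1}, {1,2}, {1,3}} works instead.
--
-- Z(L(G)) ≥ n − 2: when an edge u forces an edge w, all edges at both endpoints of u are black afterwards. So
-- the initially white edges are forced through pairwise distinct common endpoints, none of them the far end of
-- the first forcer or the far end of the last forced edge. Hence at most n − 2 edges start white, and
-- Z(L(G)) ≥ |E(G)| − (n − 2) ≥ n − 2.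

open import Defs hiding (sym)
open import Data.Bool using (Bool; true; false; T; if_then_else_; _∧_)
open import Data.Bool.Properties using (T-≡; T-∧)
open import Data.Bool.ListAction using (any)
import Data.Bool as Bool
open import Data.Empty using (⊥-elim)
open import Data.Fin using (Fin; zero; suc; punchOut; toℕ; fromℕ<) renaming (_≟_ to _≟ᶠ_)
open import Data.Fin.Properties using (suc-injective; punchOut-injective; any?; toℕ-injective; toℕ-fromℕ<; toℕ<n; injective⇒≤)
open import Data.Fin.Subset using (Subset; _∈_; _∉_; ∣_∣; ∁; outside; inside)
open import Data.Fin.Subset.Properties using (_∈?_; ∈⊤; x∈∁p⇒x∉p; ∣p∣≤n; ∣∁p∣≡n∸∣p∣)
open import Data.List using (_∷_; applyUpTo; allFin)
open import Data.List.Membership.Propositional using () renaming (_∈_ to _∈ˡ_)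
open import Data.List.Membership.Propositional.Properties using (∈-applyUpTo⁻; ∈-allFin)
open import Data.List.Relation.Unary.Any using (here; there)
open import Data.List.Relation.Unary.Any.Properties using (any⁺; any⁻)
import Data.List.Relation.Unary.Any as Any
open import Data.Maybe using (Maybe; just)
open import Data.Maybe.Properties using (just-injective)
open import Data.Nat using (ℕ; zero; suc; _≤_; _<_; _+_; _∸_; _*_; z≤n; s≤s; _≟_; _≤?_)
open import Data.Nat.Properties
  using (≤-refl; ≤-trans; <-trans; <-irrefl; <-asym; <-cmp; <-irrelevant; n≤1+n; n<1+n; 1+n≰n; <⇒≤; <⇒≱; ≰⇒>;
         ≤∧≢⇒<; m≤n⇒m<n∨m≡n; +-identityʳ; +-monoʳ-≤; +-cancelʳ-≤; m+[n∸m]≡n; module ≤-Reasoning)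
open import Data.Product using (∃-syntax; _×_; _,_; proj₁; proj₂)
open import Data.Product.Properties using (≡-dec)
open import Data.Sum using (_⊎_; inj₁; inj₂; swap)
open import Data.Vec using (lookup; tabulate; []; _∷_; here; there)
open import Data.Vec.Properties using ([]=⇒lookup; lookup⇒[]=; []≔-updates; []≔-minimal; lookup∘update′; lookup∘tabulate)
open import Function using (_∘_; _⇔_; Equivalence; mk⇔; case_of_)
open import Function.Definitions using (Injective)
import Function.Properties.Equivalence as ⇔
open import Relation.Binary.PropositionalEquality
open import Relation.Binary.Construct.Closure.ReflexiveTransitive using (ε; _◅_)
open import Relation.Binary.Definitions using (tri<; tri≈; tri>)
open import Relation.Nullary using (¬_; Dec; yes; no; contradiction)
open import Relation.Nullary.Decidable using (does; dec-true; toWitness; _×-dec_; _⊎-dec_; ¬?; decidable-stable; does-⇔)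
open import Axiom.UniquenessOfIdentityProofs using (module Decidable⇒UIP)
open Decidable⇒UIP Bool._≟_ using () renaming (≡-irrelevant to Bool-≡-irrelevant)

2+k≤n⇒k≤n∸2 : ∀ {k n} → 2 + k ≤ n → k ≤ n ∸ 2
2+k≤n⇒k≤n∸2 (s≤s (s≤s k≤n)) = k≤n

k<n∸2⇒3+k≤n : ∀ {k n} → k < n ∸ 2 → 3 + k ≤ n
k<n∸2⇒3+k≤n {n = suc (suc n)} k<n∸2 = s≤s (s≤s k<n∸2)

-- Counting members of a subset through injections

InjectiveOn : ∀ {m k} (p : Subset m) → (∀ x → x ∈ p → Fin k) → Set
InjectiveOn p f = ∀ {x y} (x∈p : x ∈ p) (y∈p : y ∈ p) → f x x∈p ≡ f y y∈p → x ≡ y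

Avoids : ∀ {m k} {p : Subset m} → (∀ x → x ∈ p → Fin k) → Fin k → Set
Avoids f b = ∀ x x∈p → f x x∈p ≢ b

∣p∣≤-injection : ∀ {m k} (p : Subset m) (f : ∀ x → x ∈ p → Fin k) → InjectiveOn p f → ∣ p ∣ ≤ k
∣p∣≤-injection [] f inj = z≤n
∣p∣≤-injection (outside ∷ p) f inj =
  ∣p∣≤-injection p (λ x → f (suc x) ∘ there) λ x∈p y∈p → suc-injective ∘ inj (there x∈p) (there y∈p)
∣p∣≤-injection {k = zero} (inside ∷ p) f inj = contradiction (f zero here) λ ()
∣p∣≤-injection {k = suc k} (inside ∷ p) f inj = s≤s (∣p∣≤-injection p g g-injective)
  where
  f₀≢ : ∀ {x} (x∈p : x ∈ p) → f zero here ≢ f (suc x) (there x∈p)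
  f₀≢ x∈p eq with () ← inj here (there x∈p) eq
  g : ∀ x → x ∈ p → Fin k
  g x x∈p = punchOut (f₀≢ x∈p)
  g-injective : InjectiveOn p g
  g-injective x∈p y∈p = suc-injective ∘ inj _ _ ∘ punchOut-injective (f₀≢ x∈p) (f₀≢ y∈p)

module _ {m k} {p : Subset m} {f : ∀ x → x ∈ p → Fin (suc k)} {b : Fin (suc k)} (f-avoids-b : Avoids f b) where

  punchOutOn : ∀ x → x ∈ p → Fin k
  punchOutOn x x∈p = punchOut (f-avoids-b x x∈p ∘ sym)

  punchOutOn-injective : InjectiveOn p f → InjectiveOn p punchOutOn
  punchOutOn-injective inj x∈p y∈p =
    inj x∈p y∈p ∘ punchOut-injective (f-avoids-b _ x∈p ∘ sym) (f-avoids-b _ y∈p ∘ sym)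

  punchOutOn-avoids : ∀ {t} (b≢t : b ≢ t) → Avoids f t → Avoids punchOutOn (punchOut b≢t)
  punchOutOn-avoids b≢t f-avoids-t x x∈p = f-avoids-t x x∈p ∘ punchOut-injective _ b≢t

∣p∣<-injection-avoiding : ∀ {m k} {p : Subset m} {f : ∀ x → x ∈ p → Fin k} {b : Fin k} →
  InjectiveOn p f → Avoids f b → ∣ p ∣ < k
∣p∣<-injection-avoiding {k = suc k} {p} inj f-avoids-b =
  s≤s (∣p∣≤-injection p (punchOutOn f-avoids-b) (punchOutOn-injective f-avoids-b inj))

2+∣p∣≤-injection-avoiding : ∀ {m k} {p : Subset m} {f : ∀ x → x ∈ p → Fin k} {b t : Fin k} →
  InjectiveOn p f → b ≢ t → Avoids f b → Avoids f t → 2 + ∣ p ∣ ≤ k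
2+∣p∣≤-injection-avoiding {k = suc k} inj b≢t f-avoids-b f-avoids-t =
  s≤s (∣p∣<-injection-avoiding (punchOutOn-injective f-avoids-b inj) (punchOutOn-avoids f-avoids-b b≢t f-avoids-t))

image : ∀ {K m} → (Fin K → Fin m) → Subset m
image f = tabulate λ x → does (any? λ r → f r ≟ᶠ x)

module _ {K m} {f : Fin K → Fin m} where

  ∈-image⁺ : ∀ r → f r ∈ image f
  ∈-image⁺ r = lookup⇒[]= (f r) (image f)
    (trans (lookup∘tabulate _ (f r)) (dec-true (any? λ r′ → f r′ ≟ᶠ f r) (r , refl)))

  ∈-image⁻ : ∀ {x} → x ∈ image f → ∃[ r ] f r ≡ x
  ∈-image⁻ {x} x∈ with any? (λ r → f r ≟ᶠ x) | trans (sym (lookup∘tabulate _ x)) ([]=⇒lookup x∈)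
  ... | yes hit | _ = hit
  ... | no _    | ()

  ∣image∣≤ : ∣ image f ∣ ≤ K
  ∣image∣≤ = ∣p∣≤-injection (image f) (λ _ x∈ → proj₁ (∈-image⁻ x∈))
    λ x∈ y∈ eq → trans (sym (proj₂ (∈-image⁻ x∈))) (trans (cong f eq) (proj₂ (∈-image⁻ y∈)))

injective⇒surjective : ∀ {n} {f : Fin n → Fin n} → Injective _≡_ _≡_ f → ∀ v → ∃[ i ] f i ≡ v
injective⇒surjective {suc n} {f} f-injective v with any? (λ i → f i ≟ᶠ v)
... | yes hit = hit
... | no miss = contradiction (injective⇒≤ g-injective) 1+n≰n
  where
  g : Fin (suc n) → Fin n
  g i = punchOut {i = v} {j = f i} λ v≡fi → miss (i , sym v≡fi)
  g-injective : Injective _≡_ _≡_ g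
  g-injective {i} {j} =
    f-injective ∘ punchOut-injective (λ v≡fi → miss (i , sym v≡fi)) (λ v≡fj → miss (j , sym v≡fj))

-- Distances 0 and 1 and resolving sets

T-injective : ∀ {a b} → (T a → T b) → (T b → T a) → a ≡ b
T-injective {false} {false} _ _ = refl
T-injective {false} {true}  _ b⇒a = ⊥-elim (b⇒a _)
T-injective {true}  {false} a⇒b _ = ⊥-elim (a⇒b _)
T-injective {true}  {true}  _ _ = refl

firstTrue-∈ : ∀ (f : ℕ → Bool) ks {k} → firstTrue f ks ≡ just k → k ∈ˡ ks
firstTrue-∈ f (k ∷ ks) eq with f k
... | true  = here (sym (just-injective eq))
... | false = there (firstTrue-∈ f ks eq)

module _ {m} (H : Graph m) where

  within₀-≢ : ∀ {u v} → u ≢ v → within H 0 u v ≡ false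
  within₀-≢ {u} {v} u≢v with u ≟ᶠ v
  ... | yes u≡v = contradiction u≡v u≢v
  ... | no _    = refl

  within₀-refl : ∀ u → within H 0 u u ≡ true
  within₀-refl u with u ≟ᶠ u
  ... | yes _   = refl
  ... | no u≢u  = contradiction refl u≢u

  within₁-≢ : ∀ {u v} → u ≢ v → within H 1 u v ≡ adj H u v
  within₁-≢ {u} {v} u≢v rewrite within₀-≢ u≢v = T-injective viaEdge⇒adj adj⇒viaEdge
    where
    viaVertex : Fin m → Bool
    viaVertex w = within H 0 u w ∧ adj H w v
    adj⇒viaEdge : T (adj H u v) → T (any viaVertex (allFin m))
    adj⇒viaEdge uv = any⁺ viaVertex (Any.map (λ { refl → Equivalence.from T-∧ (u~u , uv) }) (∈-allFin u))
      where
      u~u : T (within H 0 u u)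
      u~u = Equivalence.from T-≡ (within₀-refl u)
    viaEdge⇒adj : T (any viaVertex (allFin m)) → T (adj H u v)
    viaEdge⇒adj walk with w , u~w∧wv ← Any.satisfied (any⁻ viaVertex (allFin m) walk)
      with u~w , wv ← Equivalence.to T-∧ u~w∧wv
      with refl ← toWitness {a? = u ≟ᶠ w} u~w = wv

-- On H : Graph (suc m), dist searches upTo (2 + m) = 0 ∷ 1 ∷ applyUpTo (2 +_) m.
firstTrueFrom2-≥2 : ∀ {m} (H : Graph (suc m)) u v {k} →
  firstTrue (λ k → within H k u v) (applyUpTo (2 +_) m) ≡ just k → 2 ≤ k
firstTrueFrom2-≥2 {m} H u v eq with _ , _ , k≡2+i ← ∈-applyUpTo⁻ (2 +_) (firstTrue-∈ _ (applyUpTo (2 +_) m) eq) =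
  subst (2 ≤_) (sym k≡2+i) (s≤s (s≤s z≤n))

adj⇒≢ : ∀ {m} (H : Graph m) {u v} → Adj H u v → u ≢ v
adj⇒≢ H {u} uv refl = case trans (sym uv) (irrefl H u) of λ ()

dist-refl : ∀ {m} (H : Graph m) u → dist H u u ≡ just 0
dist-refl {suc m} H u rewrite within₀-refl H u = refl

dist-≢ : ∀ {m} (H : Graph (suc m)) {u v} → u ≢ v →
  dist H u v ≡ (if adj H u v then just 1 else firstTrue (λ k → within H k u v) (applyUpTo (2 +_) m))
dist-≢ {m} H {u} {v} u≢v =
  cong₂ (λ walk₀ walk₁ → if walk₀ then just 0 else if walk₁ then just 1 else later) (within₀-≢ H u≢v) (within₁-≢ H u≢v)
  where
  later : Maybe ℕ
  later = firstTrue (λ k → within H k u v) (applyUpTo (2 +_) m)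

dist≢0 : ∀ {m} (H : Graph m) {u v} → u ≢ v → dist H u v ≢ just 0
dist≢0 {suc m} H {u} {v} u≢v eq with adj H u v | dist-≢ H u≢v
... | true  | d = case trans (sym d) eq of λ ()
... | false | d = case firstTrueFrom2-≥2 H u v (trans (sym d) eq) of λ ()

dist-adj : ∀ {m} (H : Graph m) {u v} → Adj H u v → dist H u v ≡ just 1
dist-adj {suc m} H {u} {v} uv with dist-≢ H (adj⇒≢ H uv)
... | d rewrite uv = d

dist≢1 : ∀ {m} (H : Graph m) {u v} → u ≢ v → ¬ Adj H u v → dist H u v ≢ just 1
dist≢1 {suc m} H {u} {v} u≢v ¬uv eq with adj H u v | dist-≢ H u≢v
... | true  | _ = ¬uv refl
... | false | d = case firstTrueFrom2-≥2 H u v (trans (sym d) eq) of λ { (s≤s ()) }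

dist-separatedBy : ∀ {m} (H : Graph m) {u v x} → v ≢ x → adj H u x ≡ true → adj H v x ≡ false →
  dist H u x ≢ dist H v x
dist-separatedBy H v≢x ux vx eq =
  dist≢1 H v≢x (λ vx′ → case trans (sym vx) vx′ of λ ()) (trans (sym eq) (dist-adj H ux))

resolving-bySeparatingNeighbourhoods : ∀ {m} (H : Graph m) (W : Subset m) →
  (∀ {u v} → u ∉ W → v ∉ W → (∀ {x} → x ∈ W → adj H u x ≡ adj H v x) → u ≡ v) → Resolving H W
resolving-bySeparatingNeighbourhoods H W separating u v u≢v with u ∈? W | v ∈? W
... | yes u∈W | _       = u , u∈W , λ eq → dist≢0 H (u≢v ∘ sym) (trans (sym eq) (dist-refl H u))
... | no _    | yes v∈W = v , v∈W , λ eq → dist≢0 H u≢v (trans eq (dist-refl H v))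
... | no u∉W  | no v∉W
  with any? (λ x → x ∈? W ×-dec ¬? (adj H u x Bool.≟ adj H v x))
...   | no noneDiffer = contradiction (separating u∉W v∉W sameAdjacency) u≢v
  where
  sameAdjacency : ∀ {x} → x ∈ W → adj H u x ≡ adj H v x
  sameAdjacency {x} x∈W = decidable-stable (adj H u x Bool.≟ adj H v x) (noneDiffer ∘ λ differ → x , x∈W , differ)
...   | yes (x , x∈W , differ) with adj H u x in ux | adj H v x in vx
...     | true  | true  = contradiction refl differ
...     | false | false = contradiction refl differ
...     | true  | false = x , x∈W , dist-separatedBy H (λ { refl → v∉W x∈W }) ux vx
...     | false | true  = x , x∈W , dist-separatedBy H (λ { refl → u∉W x∈W }) vx ux ∘ sym

-- Edges of G as vertices of L(G)

module Edges {n} (G : Graph n) where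

  _∈ᴱ_ : Fin n → Edge G → Set
  v ∈ᴱ ((a , b) , _) = v ≡ a ⊎ v ≡ b

  commonEndpoint : (e f : Edge G) → ShareEndpoint {G = G} e f → ∃[ v ] (v ∈ᴱ e × v ∈ᴱ f)
  commonEndpoint ((a , _) , _) _ (inj₁ a≡c)                = a , inj₁ refl , inj₁ a≡c
  commonEndpoint ((a , _) , _) _ (inj₂ (inj₁ a≡d))         = a , inj₁ refl , inj₂ a≡d
  commonEndpoint ((_ , b) , _) _ (inj₂ (inj₂ (inj₁ b≡c))) = b , inj₂ refl , inj₁ b≡c
  commonEndpoint ((_ , b) , _) _ (inj₂ (inj₂ (inj₂ b≡d))) = b , inj₂ refl , inj₂ b≡d

  shareEndpoint : ∀ {v} (e f : Edge G) → v ∈ᴱ e → v ∈ᴱ f → ShareEndpoint {G = G} e f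
  shareEndpoint _ _ (inj₁ refl) (inj₁ refl) = inj₁ refl
  shareEndpoint _ _ (inj₁ refl) (inj₂ refl) = inj₂ (inj₁ refl)
  shareEndpoint _ _ (inj₂ refl) (inj₁ refl) = inj₂ (inj₂ (inj₁ refl))
  shareEndpoint _ _ (inj₂ refl) (inj₂ refl) = inj₂ (inj₂ (inj₂ refl))

  otherEndpoint : ∀ {v} (e : Edge G) → v ∈ᴱ e → ∃[ o ] (o ∈ᴱ e × o ≢ v)
  otherEndpoint ((a , b) , a<b , _) (inj₁ refl) = b , inj₂ refl , λ { refl → <-irrefl refl a<b }
  otherEndpoint ((a , b) , a<b , _) (inj₂ refl) = a , inj₁ refl , λ { refl → <-irrefl refl a<b }

  edgeOf : ∀ {a b} → Adj G a b → ∃[ e ] (a ∈ᴱ e × b ∈ᴱ e)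
  edgeOf {a} {b} ab with <-cmp (toℕ a) (toℕ b)
  ... | tri< a<b _ _ = ((a , b) , a<b , ab) , inj₁ refl , inj₂ refl
  ... | tri> _ _ b<a = ((b , a) , b<a , trans (Graph.sym G b a) ab) , inj₂ refl , inj₁ refl
  ... | tri≈ _ a≡b _ with refl ← toℕ-injective a≡b = case trans (sym ab) (irrefl G a) of λ ()

  edge-≡ : (e f : Edge G) → (∀ {v} → v ∈ᴱ e → v ∈ᴱ f) → e ≡ f
  edge-≡ ((a , b) , a<b , ab) ((c , d) , c<d , cd) e⊆f with e⊆f (inj₁ refl) | e⊆f (inj₂ refl)
  ... | inj₁ refl | inj₂ refl = cong ((a , b) ,_) (cong₂ _,_ (<-irrelevant a<b c<d) (Bool-≡-irrelevant ab cd))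
  ... | inj₁ refl | inj₁ refl = contradiction a<b (<-irrefl refl)
  ... | inj₂ refl | inj₂ refl = contradiction a<b (<-irrefl refl)
  ... | inj₂ refl | inj₁ refl = contradiction c<d (<-asym a<b)

-- Zero forcing in a line graph

module LineGraphForcing {n m} {G : Graph n} {H : Graph m} (L : IsLineGraph G H) where
  open IsLineGraph L
  open Edges G

  AllBlackAt : Subset m → Fin n → Set
  AllBlackAt c v = ∀ {j} → j ∉ c → ¬ v ∈ᴱ to j

  HasWhiteEdgeAt : Subset m → Fin n → Set
  HasWhiteEdgeAt c v = ∃[ j ] (j ∉ c × v ∈ᴱ to j)

  hasWhiteEdgeAt⇒¬allBlackAt : ∀ {c v} → HasWhiteEdgeAt c v → ¬ AllBlackAt c v
  hasWhiteEdgeAt⇒¬allBlackAt (j , j∉c , v∈j) allBlack = allBlack j∉c v∈j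

  module _ {c c′ : Subset m} where

    forcer forced : ForceStep H c c′ → Fin m
    forcer (u , _) = u
    forced (_ , w , _) = w

    sharedEndpoint : (s : ForceStep H c c′) → ∃[ v ] (v ∈ᴱ to (forcer s) × v ∈ᴱ to (forced s))
    sharedEndpoint (u , w , _ , uw , _) = commonEndpoint (to u) (to w) (proj₂ (proj₁ (adjOK u w) uw))

    forcingVertex : ForceStep H c c′ → Fin n
    forcingVertex = proj₁ ∘ sharedEndpoint

    forcingVertex-∈forcer : (s : ForceStep H c c′) → forcingVertex s ∈ᴱ to (forcer s)
    forcingVertex-∈forcer = proj₁ ∘ proj₂ ∘ sharedEndpoint

    forcingVertex-∈forced : (s : ForceStep H c c′) → forcingVertex s ∈ᴱ to (forced s)
    forcingVertex-∈forced = proj₂ ∘ proj₂ ∘ sharedEndpoint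

    forced-white : (s : ForceStep H c c′) → forced s ∉ c
    forced-white (_ , _ , _ , _ , w-white , _) w∈c = case trans (sym ([]=⇒lookup w∈c)) w-white of λ ()

    black-after : (s : ForceStep H c c′) → ∀ {i} → i ∈ c → i ∈ c′
    black-after (_ , w , _ , _ , _ , _ , refl) {i} i∈c with i ≟ᶠ w
    ... | yes refl = []≔-updates c w
    ... | no i≢w   = []≔-minimal c i w i≢w i∈c

    white-before : (s : ForceStep H c c′) → ∀ {i} → i ∉ c′ → i ∉ c
    white-before s i∉c′ = i∉c′ ∘ black-after s

    white-after : (s : ForceStep H c c′) → ∀ {i} → i ∉ c → i ≢ forced s → i ∉ c′
    white-after (_ , w , _ , _ , _ , _ , refl) {i} i∉c i≢w i∈c′ =
      i∉c (lookup⇒[]= i c (trans (sym (lookup∘update′ i≢w c true)) ([]=⇒lookup i∈c′)))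

    -- every edge at an endpoint of the forcer other than the forced one was already black
    allBlackAt-forcer : (s : ForceStep H c c′) → ∀ {v} → v ∈ᴱ to (forcer s) → AllBlackAt c′ v
    allBlackAt-forcer s@(u , w , u∈c , _ , _ , rule , refl) {v} v∈u {j} j∉c′ v∈j with j ≟ᶠ w | j ≟ᶠ u
    ... | yes refl | _        = j∉c′ ([]≔-updates c w)
    ... | no _     | yes refl = j∉c′ (black-after s u∈c)
    ... | no j≢w   | no j≢u   = j∉c′ (black-after s (rule j uj j≢w))
      where
      uj : Adj H u j
      uj = proj₂ (adjOK u j) (j≢u ∘ sym , shareEndpoint (to u) (to j) v∈u v∈j)

  -- the common endpoint of i and the edge that forces it in D
  forcingVertexOf : ∀ {c} → ZeroForcingSet H c → ∀ i → i ∉ c → Fin n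
  forcingVertexOf ε       i i∉⊤ = contradiction ∈⊤ i∉⊤
  forcingVertexOf (s ◅ D) i i∉c with i ≟ᶠ forced s
  ... | yes _  = forcingVertex s
  ... | no i≢w = forcingVertexOf D i (white-after s i∉c i≢w)

  forcingVertexOf-∈ : ∀ {c} (D : ZeroForcingSet H c) i (i∉c : i ∉ c) → forcingVertexOf D i i∉c ∈ᴱ to i
  forcingVertexOf-∈ ε       i i∉⊤ = contradiction ∈⊤ i∉⊤
  forcingVertexOf-∈ (s ◅ D) i i∉c with i ≟ᶠ forced s
  ... | yes refl = forcingVertex-∈forced s
  ... | no i≢w   = forcingVertexOf-∈ D i (white-after s i∉c i≢w)

  forcingVertexOf-avoids-allBlack : ∀ {c v} (D : ZeroForcingSet H c) → AllBlackAt c v →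
    ∀ i (i∉c : i ∉ c) → forcingVertexOf D i i∉c ≢ v
  forcingVertexOf-avoids-allBlack D allBlack i i∉c refl = allBlack i∉c (forcingVertexOf-∈ D i i∉c)

  forcingVertex-allBlackAfter : ∀ {c c′} (s : ForceStep H c c′) → AllBlackAt c′ (forcingVertex s)
  forcingVertex-allBlackAfter s = allBlackAt-forcer s (forcingVertex-∈forcer s)

  forcingVertexOf-injective : ∀ {c} (D : ZeroForcingSet H c) {i j} (i∉c : i ∉ c) (j∉c : j ∉ c) →
    forcingVertexOf D i i∉c ≡ forcingVertexOf D j j∉c → i ≡ j
  forcingVertexOf-injective ε i∉⊤ _ = contradiction ∈⊤ i∉⊤
  forcingVertexOf-injective (s ◅ D) {i} {j} i∉c j∉c eq with i ≟ᶠ forced s | j ≟ᶠ forced s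
  ... | yes refl | yes refl = refl
  ... | yes refl | no _     = ⊥-elim (forcingVertexOf-avoids-allBlack D (forcingVertex-allBlackAfter s) j _ (sym eq))
  ... | no _     | yes refl = ⊥-elim (forcingVertexOf-avoids-allBlack D (forcingVertex-allBlackAfter s) i _ eq)
  ... | no _     | no _     = forcingVertexOf-injective D _ _ eq

  hasWhiteEdgeAfter⇒≢forcingVertex : ∀ {c c′ v} (s : ForceStep H c c′) → HasWhiteEdgeAt c′ v → v ≢ forcingVertex s
  hasWhiteEdgeAfter⇒≢forcingVertex s white refl = hasWhiteEdgeAt⇒¬allBlackAt white (forcingVertex-allBlackAfter s)

  forcingVertexOf-step-avoids : ∀ {c c′ v} (s : ForceStep H c c′) (D : ZeroForcingSet H c′) →
    v ≢ forcingVertex s → (∀ i (i∉c′ : i ∉ c′) → forcingVertexOf D i i∉c′ ≢ v) →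
    ∀ i (i∉c : i ∉ c) → forcingVertexOf (s ◅ D) i i∉c ≢ v
  forcingVertexOf-step-avoids s D v≢fv avoids i i∉c with i ≟ᶠ forced s
  ... | yes _  = v≢fv ∘ sym
  ... | no i≢w = avoids i _

  -- the endpoint of the last forced edge that is not its forcing vertex
  lastEndpoint-avoided : ∀ {c c′} (s : ForceStep H c c′) (D : ZeroForcingSet H c′) →
    ∃[ b ] (HasWhiteEdgeAt c b × ∀ i (i∉c : i ∉ c) → forcingVertexOf (s ◅ D) i i∉c ≢ b)
  lastEndpoint-avoided s ε with b , b∈w , b≢fv ← otherEndpoint (to (forced s)) (forcingVertex-∈forced s) =
    b , (forced s , forced-white s , b∈w) , forcingVertexOf-step-avoids s ε b≢fv λ i i∉⊤ → contradiction ∈⊤ i∉⊤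
  lastEndpoint-avoided s (s′ ◅ D) with b , (j , j∉c′ , b∈j) , avoids ← lastEndpoint-avoided s′ D =
    b , (j , white-before s j∉c′ , b∈j) ,
    forcingVertexOf-step-avoids s (s′ ◅ D) (hasWhiteEdgeAfter⇒≢forcingVertex s (j , j∉c′ , b∈j)) avoids

  2+∣∁zeroForcingSet∣≤ : 3 ≤ n → ∀ {S} → ZeroForcingSet H S → 2 + ∣ ∁ S ∣ ≤ n
  2+∣∁zeroForcingSet∣≤ 3≤n {S} ε = ≤-trans (+-monoʳ-≤ 2 noWhite) (≤-trans (n≤1+n 2) 3≤n)
    where
    noWhite : ∣ ∁ S ∣ ≤ 0
    noWhite = ∣p∣≤-injection (∁ S) (λ _ i∈∁⊤ → contradiction ∈⊤ (x∈∁p⇒x∉p i∈∁⊤))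
      (λ i∈∁⊤ → contradiction ∈⊤ (x∈∁p⇒x∉p i∈∁⊤))
  2+∣∁zeroForcingSet∣≤ 3≤n {S} (s ◅ ε) = ≤-trans (+-monoʳ-≤ 2 oneWhite) 3≤n
    where
    onlyForced : ∀ {i} → i ∈ ∁ S → i ≡ forced s
    onlyForced {i} i∈∁S = decidable-stable (i ≟ᶠ forced s) (contradiction ∈⊤ ∘ white-after s (x∈∁p⇒x∉p i∈∁S))
    oneWhite : ∣ ∁ S ∣ ≤ 1
    oneWhite = ∣p∣≤-injection (∁ S) (λ _ _ → zero)
      (λ i∈∁S j∈∁S _ → trans (onlyForced i∈∁S) (sym (onlyForced j∈∁S)))
  2+∣∁zeroForcingSet∣≤ 3≤n {S} (s ◅ s′ ◅ D)
    with t , t∈u , t≢fv ← otherEndpoint (to (forcer s)) (forcingVertex-∈forcer s)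
       | b , white-b , avoids-b ← lastEndpoint-avoided s′ D =
    2+∣p∣≤-injection-avoiding {f = f} f-injective b≢t
      (λ i i∈∁S → forcingVertexOf-step-avoids s (s′ ◅ D) (hasWhiteEdgeAfter⇒≢forcingVertex s white-b) avoids-b i _)
      (λ i i∈∁S → forcingVertexOf-step-avoids s (s′ ◅ D) t≢fv (forcingVertexOf-avoids-allBlack (s′ ◅ D) t-allBlack) i _)
    where
    f : ∀ i → i ∈ ∁ S → Fin n
    f i i∈∁S = forcingVertexOf (s ◅ s′ ◅ D) i (x∈∁p⇒x∉p i∈∁S)
    f-injective : InjectiveOn (∁ S) f
    f-injective i∈∁S j∈∁S = forcingVertexOf-injective (s ◅ s′ ◅ D) (x∈∁p⇒x∉p i∈∁S) (x∈∁p⇒x∉p j∈∁S)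
    t-allBlack : AllBlackAt _ t
    t-allBlack = allBlackAt-forcer s t∈u
    b≢t : b ≢ t
    b≢t refl = hasWhiteEdgeAt⇒¬allBlackAt white-b t-allBlack

  ∣zeroForcingSet∣-lowerBound : 3 ≤ n → ∀ {S} → ZeroForcingSet H S → m ≤ ∣ S ∣ + (n ∸ 2)
  ∣zeroForcingSet∣-lowerBound 3≤n {S} S-forcing = begin
    m                    ≡⟨ m+[n∸m]≡n (∣p∣≤n S) ⟨
    ∣ S ∣ + (m ∸ ∣ S ∣)  ≡⟨ cong (∣ S ∣ +_) (∣∁p∣≡n∸∣p∣ S) ⟨
    ∣ S ∣ + ∣ ∁ S ∣      ≤⟨ +-monoʳ-≤ ∣ S ∣ (2+k≤n⇒k≤n∸2 (2+∣∁zeroForcingSet∣≤ 3≤n S-forcing)) ⟩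
    ∣ S ∣ + (n ∸ 2)      ∎
    where open ≤-Reasoning


-- Pairs of positions

_∈ₚ_ : ℕ → ℕ × ℕ → Set
k ∈ₚ P = k ≡ proj₁ P ⊎ k ≡ proj₂ P

Meets : ℕ × ℕ → ℕ × ℕ → Set
Meets P Q = proj₁ Q ∈ₚ P ⊎ proj₂ Q ∈ₚ P

pathPair : ℕ → ℕ × ℕ
pathPair k = k , suc k

SortedBelow : ℕ → ℕ × ℕ → Set
SortedBelow n P = proj₁ P < proj₂ P × proj₂ P < n

meets⇒common : ∀ {P Q} → Meets P Q → ∃[ k ] (k ∈ₚ P × k ∈ₚ Q)
meets⇒common {Q = Q} (inj₁ k∈P) = proj₁ Q , k∈P , inj₁ refl
meets⇒common {Q = Q} (inj₂ k∈P) = proj₂ Q , k∈P , inj₂ refl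

common⇒meets : ∀ {k P Q} → k ∈ₚ P → k ∈ₚ Q → Meets P Q
common⇒meets k∈P (inj₁ refl) = inj₁ k∈P
common⇒meets k∈P (inj₂ refl) = inj₂ k∈P

sortPair : ℕ × ℕ → ℕ × ℕ
sortPair (i , j) with i ≤? j
... | yes _ = i , j
... | no _  = j , i

∈ₚ-sortPair : ∀ {k} P → k ∈ₚ sortPair P ⇔ k ∈ₚ P
∈ₚ-sortPair (i , j) with i ≤? j
... | yes _ = ⇔.refl
... | no _  = mk⇔ swap swap

sortPair-sortedBelow : ∀ {n i j} → i ≢ j → i < n → j < n → SortedBelow n (sortPair (i , j))
sortPair-sortedBelow {i = i} {j} i≢j i<n j<n with i ≤? j
... | yes i≤j = ≤∧≢⇒< i≤j i≢j , j<n
... | no i≰j  = ≰⇒> i≰j , i<n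

sortedPair-≡ : ∀ {P Q} → proj₁ P < proj₂ P → proj₁ Q < proj₂ Q → proj₁ P ∈ₚ Q → proj₂ P ∈ₚ Q → P ≡ Q
sortedPair-≡ i<j _     (inj₁ refl) (inj₁ refl) = contradiction i<j (<-irrefl refl)
sortedPair-≡ _   _     (inj₁ refl) (inj₂ refl) = refl
sortedPair-≡ i<j i′<j′ (inj₂ refl) (inj₁ refl) = contradiction i′<j′ (<-asym i<j)
sortedPair-≡ i<j _     (inj₂ refl) (inj₂ refl) = contradiction i<j (<-irrefl refl)

-- the members {k, k+1}, k ≤ n − 3, of the resolving set: all edges of the path 0 — 1 — ⋯ — (n − 1) but the last
IsPathPair : ℕ → ℕ × ℕ → Set
IsPathPair n P = proj₂ P ≡ suc (proj₁ P) × 3 + proj₁ P ≤ n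

SameTrace : ℕ → ℕ × ℕ → ℕ × ℕ → Set
SameTrace n P Q = ∀ k → 3 + k ≤ n → Meets P (pathPair k) ⇔ Meets Q (pathPair k)

-- for n = 5 the pairs {0,2} and {1,3} both meet each of {0,1}, {1,2}, {2,3}
Exceptional : ℕ → ℕ × ℕ → ℕ × ℕ → Set
Exceptional n P Q = n ≡ 5 × P ≡ (0 , 2) × Q ≡ (1 , 3)

sameTrace-sym : ∀ {n P Q} → SameTrace n P Q → SameTrace n Q P
sameTrace-sym same k 3+k≤n = ⇔.sym (same k 3+k≤n)

∈ₚ-≥min : ∀ {i j k} → i ≤ j → k ∈ₚ (i , j) → i ≤ k
∈ₚ-≥min _   (inj₁ refl) = ≤-refl
∈ₚ-≥min i≤j (inj₂ refl) = i≤j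

¬meetsBelow : ∀ {i j k} → i ≤ j → suc k < i → ¬ Meets (i , j) (pathPair k)
¬meetsBelow i≤j 1+k<i (inj₁ k∈) = <⇒≱ (<-trans (n<1+n _) 1+k<i) (∈ₚ-≥min i≤j k∈)
¬meetsBelow i≤j 1+k<i (inj₂ 1+k∈) = <⇒≱ 1+k<i (∈ₚ-≥min i≤j 1+k∈)

module PathTraces {n : ℕ} (5≤n : 5 ≤ n) where

  private
    3≤n : 3 ≤ n
    3≤n = ≤-trans (s≤s (s≤s (s≤s z≤n))) 5≤n
    4≤n : 4 ≤ n
    4≤n = ≤-trans (n≤1+n 4) 5≤n

  fromZero-impossible : ∀ {j j′} → ¬ IsPathPair n (0 , j) → ¬ IsPathPair n (1 , j′) →
    ¬ Exceptional n (0 , j) (1 , j′) → ¬ SameTrace n (0 , j) (1 , j′)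
  fromZero-impossible ¬pathP ¬pathQ ¬exceptional same
    with Equivalence.from (same 1 4≤n) (inj₁ (inj₁ refl))
  ... | inj₁ (inj₁ ())
  ... | inj₂ (inj₁ ())
  ... | inj₁ (inj₂ refl) = ¬pathP (refl , 3≤n)
  ... | inj₂ (inj₂ refl)
    with Equivalence.to (same 2 5≤n) (inj₁ (inj₂ refl))
  ...   | inj₁ (inj₁ ())
  ...   | inj₂ (inj₁ ())
  ...   | inj₁ (inj₂ refl) = ¬pathQ (refl , 4≤n)
  ...   | inj₂ (inj₂ refl)
    with Equivalence.from (same 3 6≤n) (inj₁ (inj₂ refl))
    where
    6≤n : 6 ≤ n
    6≤n = ≤∧≢⇒< 5≤n λ 5≡n → ¬exceptional (sym 5≡n , refl , refl)
  ...     | inj₁ (inj₁ ())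
  ...     | inj₁ (inj₂ ())
  ...     | inj₂ (inj₁ ())
  ...     | inj₂ (inj₂ ())

  nextMin-impossible : ∀ {i j j′} → suc i < j′ → j′ < n → ¬ IsPathPair n (i , j) → ¬ IsPathPair n (suc i , j′) →
    ¬ Exceptional n (i , j) (suc i , j′) → ¬ SameTrace n (i , j) (suc i , j′)
  nextMin-impossible {zero} _ _ = fromZero-impossible
  nextMin-impossible {suc i} 2+i<j′ j′<n _ _ _ same =
    ¬meetsBelow (<⇒≤ 2+i<j′) ≤-refl (Equivalence.to (same i (≤-trans 2+i<j′ (<⇒≤ j′<n))) (inj₂ (inj₁ refl)))

  smallerMin-impossible : ∀ {i j i′ j′} → SortedBelow n (i , j) → SortedBelow n (i′ , j′) → i < i′ →
    ¬ IsPathPair n (i , j) → ¬ IsPathPair n (i′ , j′) → ¬ Exceptional n (i , j) (i′ , j′) →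
    ¬ SameTrace n (i , j) (i′ , j′)
  smallerMin-impossible {i} (_ , _) (i′<j′ , j′<n) i<i′ ¬pathP ¬pathQ ¬exceptional same
    with m≤n⇒m<n∨m≡n i<i′
  ... | inj₁ 1+i<i′ = ¬meetsBelow (<⇒≤ i′<j′) 1+i<i′ (Equivalence.to (same i 3+i≤n) (inj₁ (inj₁ refl)))
    where
    3+i≤n : 3 + i ≤ n
    3+i≤n = ≤-trans (s≤s (s≤s i<i′)) (≤-trans (s≤s i′<j′) j′<n)
  ... | inj₂ refl = nextMin-impossible i′<j′ j′<n ¬pathP ¬pathQ ¬exceptional same

  largerMax-impossible : ∀ {i j j′} → i < j → j < j′ → j′ < n → ¬ IsPathPair n (i , j) →
    ¬ SameTrace n (i , j) (i , j′)
  largerMax-impossible {j = suc j} i<1+j 1+j<j′ j′<n ¬pathP same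
    with Equivalence.to (same j (≤-trans (s≤s 1+j<j′) j′<n)) (inj₂ (inj₂ refl))
  ... | inj₁ (inj₁ refl) = ¬pathP (refl , ≤-trans (s≤s 1+j<j′) j′<n)
  ... | inj₁ (inj₂ refl) = <-asym (n<1+n j) 1+j<j′
  ... | inj₂ (inj₁ refl) = <-irrefl refl i<1+j
  ... | inj₂ (inj₂ refl) = <-irrefl refl 1+j<j′

  pathTrace-injective : ∀ {P Q} → SortedBelow n P → SortedBelow n Q → ¬ IsPathPair n P → ¬ IsPathPair n Q →
    ¬ Exceptional n P Q → ¬ Exceptional n Q P → SameTrace n P Q → P ≡ Q
  pathTrace-injective {i , j} {i′ , j′} P<n Q<n ¬pathP ¬pathQ ¬exPQ ¬exQP same with <-cmp i i′
  ... | tri< i<i′ _ _ = ⊥-elim (smallerMin-impossible P<n Q<n i<i′ ¬pathP ¬pathQ ¬exPQ same)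
  ... | tri> _ _ i′<i = ⊥-elim (smallerMin-impossible Q<n P<n i′<i ¬pathQ ¬pathP ¬exQP (sameTrace-sym same))
  ... | tri≈ _ refl _ with <-cmp j j′
  ...   | tri< j<j′ _ _ = ⊥-elim (largerMax-impossible (proj₁ P<n) j<j′ (proj₂ Q<n) ¬pathP same)
  ...   | tri> _ _ j′<j = ⊥-elim (largerMax-impossible (proj₁ Q<n) j′<j (proj₂ P<n) ¬pathQ (sameTrace-sym same))
  ...   | tri≈ _ refl _ = refl

_∈ₚ?_ : ∀ k P → Dec (k ∈ₚ P)
k ∈ₚ? P = (k ≟ proj₁ P) ⊎-dec (k ≟ proj₂ P)

meets? : ∀ P Q → Dec (Meets P Q)
meets? P Q = (proj₁ Q ∈ₚ? P) ⊎-dec (proj₂ Q ∈ₚ? P)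

-- resolves the pairs below 5 when {0,2} and {1,3} are both edges
exceptionalBasis : Fin 3 → ℕ × ℕ
exceptionalBasis zero             = 0 , 1
exceptionalBasis (suc zero)       = 1 , 2
exceptionalBasis (suc (suc zero)) = 1 , 3

trace₅ : ℕ × ℕ → Bool × Bool × Bool
trace₅ P = does (meets? P (0 , 1)) , does (meets? P (1 , 2)) , does (meets? P (1 , 3))

decode₅ : Bool × Bool × Bool → ℕ × ℕ
decode₅ (true  , true  , false) = 0 , 2
decode₅ (true  , false , true ) = 0 , 3
decode₅ (true  , false , false) = 0 , 4
decode₅ (true  , true  , true ) = 1 , 4
decode₅ (false , true  , true ) = 2 , 3
decode₅ (false , true  , false) = 2 , 4
decode₅ (false , false , _    ) = 3 , 4

decode₅-trace₅ : ∀ {P} → SortedBelow 5 P → (∀ r → exceptionalBasis r ≢ P) → decode₅ (trace₅ P) ≡ P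
decode₅-trace₅ {0 , 1} _ notBasis = contradiction refl (notBasis zero)
decode₅-trace₅ {0 , 2} _ _ = refl
decode₅-trace₅ {0 , 3} _ _ = refl
decode₅-trace₅ {0 , 4} _ _ = refl
decode₅-trace₅ {1 , 2} _ notBasis = contradiction refl (notBasis (suc zero))
decode₅-trace₅ {1 , 3} _ notBasis = contradiction refl (notBasis (suc (suc zero)))
decode₅-trace₅ {1 , 4} _ _ = refl
decode₅-trace₅ {2 , 3} _ _ = refl
decode₅-trace₅ {2 , 4} _ _ = refl
decode₅-trace₅ {3 , 4} _ _ = refl
decode₅-trace₅ {_ , suc (suc (suc (suc (suc _))))} (_ , s≤s (s≤s (s≤s (s≤s (s≤s ()))))) _
decode₅-trace₅ {1 , 1} (s≤s () , _) _
decode₅-trace₅ {2 , 1} (s≤s () , _) _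
decode₅-trace₅ {2 , 2} (s≤s (s≤s ()) , _) _
decode₅-trace₅ {suc (suc (suc _)) , 1} (s≤s () , _) _
decode₅-trace₅ {suc (suc (suc _)) , 2} (s≤s (s≤s ()) , _) _
decode₅-trace₅ {suc (suc (suc _)) , 3} (s≤s (s≤s (s≤s ())) , _) _
decode₅-trace₅ {suc (suc (suc (suc _))) , 4} (s≤s (s≤s (s≤s (s≤s ()))) , _) _

exceptionalTrace-injective : ∀ {P Q} → SortedBelow 5 P → SortedBelow 5 Q →
  (∀ r → exceptionalBasis r ≢ P) → (∀ r → exceptionalBasis r ≢ Q) →
  (∀ r → Meets P (exceptionalBasis r) ⇔ Meets Q (exceptionalBasis r)) → P ≡ Q
exceptionalTrace-injective {P} {Q} P<5 Q<5 P∉basis Q∉basis same = begin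
  P                  ≡⟨ decode₅-trace₅ P<5 P∉basis ⟨
  decode₅ (trace₅ P) ≡⟨ cong decode₅ sameTrace ⟩
  decode₅ (trace₅ Q) ≡⟨ decode₅-trace₅ Q<5 Q∉basis ⟩
  Q                  ∎
  where
  open ≡-Reasoning
  sameDoes : ∀ r → does (meets? P (exceptionalBasis r)) ≡ does (meets? Q (exceptionalBasis r))
  sameDoes r = does-⇔ (same r) (meets? P (exceptionalBasis r)) (meets? Q (exceptionalBasis r))
  sameTrace : trace₅ P ≡ trace₅ Q
  sameTrace = cong₂ _,_ (sameDoes zero) (cong₂ _,_ (sameDoes (suc zero)) (sameDoes (suc (suc zero))))

-- A resolving set of size n − 2 in L(G)

module HamiltonianPositions {n m} {G : Graph n} {H : Graph m} (L : IsLineGraph G H)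
  (p : Fin n → Fin n) (p-injective : Injective _≡_ _≡_ p)
  (p-path : ∀ i j → toℕ j ≡ suc (toℕ i) → Adj G (p i) (p j)) where
  open IsLineGraph L
  open Edges G

  private
    p⁻¹ : ∀ v → ∃[ i ] p i ≡ v
    p⁻¹ = injective⇒surjective p-injective

  position : Fin n → ℕ
  position v = toℕ (proj₁ (p⁻¹ v))

  position-injective : ∀ {u v} → position u ≡ position v → u ≡ v
  position-injective {u} {v} eq = begin
    u                 ≡⟨ proj₂ (p⁻¹ u) ⟨
    p (proj₁ (p⁻¹ u)) ≡⟨ cong p (toℕ-injective eq) ⟩
    p (proj₁ (p⁻¹ v)) ≡⟨ proj₂ (p⁻¹ v) ⟩
    v                 ∎
    where open ≡-Reasoning

  position-p : ∀ i → position (p i) ≡ toℕ i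
  position-p i = cong toℕ (p-injective (proj₂ (p⁻¹ (p i))))

  endpointPositions : Edge G → ℕ × ℕ
  endpointPositions ((a , b) , _) = position a , position b

  ∈-endpointPositions⁺ : ∀ {v} e → v ∈ᴱ e → position v ∈ₚ endpointPositions e
  ∈-endpointPositions⁺ _ (inj₁ refl) = inj₁ refl
  ∈-endpointPositions⁺ _ (inj₂ refl) = inj₂ refl

  ∈-endpointPositions⁻ : ∀ {k} e → k ∈ₚ endpointPositions e → ∃[ v ] (v ∈ᴱ e × k ≡ position v)
  ∈-endpointPositions⁻ ((a , _) , _) (inj₁ k≡a) = a , inj₁ refl , k≡a
  ∈-endpointPositions⁻ ((_ , b) , _) (inj₂ k≡b) = b , inj₂ refl , k≡b

  positionPair : Fin m → ℕ × ℕ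
  positionPair x = sortPair (endpointPositions (to x))

  ∈-positionPair⁺ : ∀ {x v} → v ∈ᴱ to x → position v ∈ₚ positionPair x
  ∈-positionPair⁺ {x} = Equivalence.from (∈ₚ-sortPair (endpointPositions (to x))) ∘ ∈-endpointPositions⁺ (to x)

  ∈-positionPair⁻ : ∀ {x k} → k ∈ₚ positionPair x → ∃[ v ] (v ∈ᴱ to x × k ≡ position v)
  ∈-positionPair⁻ {x} = ∈-endpointPositions⁻ (to x) ∘ Equivalence.to (∈ₚ-sortPair (endpointPositions (to x)))

  positionPair-sortedBelow : ∀ x → SortedBelow n (positionPair x)
  positionPair-sortedBelow x with to x
  ... | (a , b) , a<b , _ = sortPair-sortedBelow (λ eq → <-irrefl (cong toℕ (position-injective eq)) a<b) (toℕ<n _) (toℕ<n _)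

  positionPair-injective : ∀ {x y} → positionPair x ≡ positionPair y → x ≡ y
  positionPair-injective {x} {y} eq = begin
    x             ≡⟨ strictlyInverseʳ x ⟨
    from (to x)   ≡⟨ cong from (edge-≡ (to x) (to y) x⊆y) ⟩
    from (to y)   ≡⟨ strictlyInverseʳ y ⟩
    y             ∎
    where
    open ≡-Reasoning
    x⊆y : ∀ {v} → v ∈ᴱ to x → v ∈ᴱ to y
    x⊆y v∈x with w , w∈y , pv≡pw ← ∈-positionPair⁻ {y} (subst (_ ∈ₚ_) eq (∈-positionPair⁺ v∈x)) =
      subst (_∈ᴱ to y) (sym (position-injective pv≡pw)) w∈y

  adj⇔meets : ∀ {x y} → x ≢ y → Adj H x y ⇔ Meets (positionPair x) (positionPair y)
  adj⇔meets {x} {y} x≢y =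
    mk⇔ (share⇒meets ∘ proj₂ ∘ proj₁ (adjOK x y)) (proj₂ (adjOK x y) ∘ (x≢y ,_) ∘ meets⇒share)
    where
    share⇒meets : ShareEndpoint {G = G} (to x) (to y) → Meets (positionPair x) (positionPair y)
    share⇒meets sh with v , v∈x , v∈y ← commonEndpoint (to x) (to y) sh =
      common⇒meets (∈-positionPair⁺ v∈x) (∈-positionPair⁺ v∈y)
    meets⇒share : Meets (positionPair x) (positionPair y) → ShareEndpoint {G = G} (to x) (to y)
    meets⇒share mt with k , k∈x , k∈y ← meets⇒common mt
      with v , v∈x , refl ← ∈-positionPair⁻ {x} k∈x | w , w∈y , pv≡pw ← ∈-positionPair⁻ {y} k∈y =
      shareEndpoint (to x) (to y) v∈x (subst (_∈ᴱ to y) (sym (position-injective pv≡pw)) w∈y)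

  Realized : ℕ × ℕ → Set
  Realized P = ∃[ x ] positionPair x ≡ P

  realized? : ∀ P → Dec (Realized P)
  realized? P = any? λ x → ≡-dec _≟_ _≟_ (positionPair x) P

  edge-realized : ∀ {a b} → Adj G a b → position a < position b → Realized (position a , position b)
  edge-realized {a} {b} ab pa<pb with e , a∈e , b∈e ← edgeOf ab =
    from e , sym (sortedPair-≡ pa<pb (proj₁ (positionPair-sortedBelow (from e)))
                   (∈-positionPair⁺ (toFrom a∈e)) (∈-positionPair⁺ (toFrom b∈e)))
    where
    toFrom : ∀ {v} → v ∈ᴱ e → v ∈ᴱ to (from e)
    toFrom = subst (_ ∈ᴱ_) (sym (strictlyInverseˡ e))

  pathPair-realized : ∀ k → suc k < n → Realized (pathPair k)
  pathPair-realized k 1+k<n = subst Realized (cong₂ _,_ pi≡k pj≡1+k) (edge-realized (p-path i j j≡1+i) pi<pj)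
    where
    i j : Fin n
    i = fromℕ< (<-trans (n<1+n k) 1+k<n)
    j = fromℕ< 1+k<n
    j≡1+i : toℕ j ≡ suc (toℕ i)
    j≡1+i = trans (toℕ-fromℕ< 1+k<n) (cong suc (sym (toℕ-fromℕ< _)))
    pi≡k : position (p i) ≡ k
    pi≡k = trans (position-p i) (toℕ-fromℕ< _)
    pj≡1+k : position (p j) ≡ suc k
    pj≡1+k = trans (position-p j) (toℕ-fromℕ< 1+k<n)
    pi<pj : position (p i) < position (p j)
    pi<pj = subst₂ _<_ (sym pi≡k) (sym pj≡1+k) (n<1+n k)

  module PairBasis {K} (basis : Fin K → ℕ × ℕ) (realized : ∀ r → Realized (basis r)) where

    member : Fin K → Fin m
    member r = proj₁ (realized r)

    W : Subset m
    W = image member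

    ∣W∣≤K : ∣ W ∣ ≤ K
    ∣W∣≤K = ∣image∣≤ {f = member}

    ∉W⇒∉basis : ∀ {x} → x ∉ W → ∀ r → basis r ≢ positionPair x
    ∉W⇒∉basis x∉W r eq = x∉W (subst (_∈ W) (positionPair-injective (trans (proj₂ (realized r)) eq)) (∈-image⁺ r))

    meetsBasis⇔adj : ∀ {x} → x ∉ W → ∀ r → Meets (positionPair x) (basis r) ⇔ Adj H x (member r)
    meetsBasis⇔adj {x} x∉W r =
      subst (λ Q → Meets (positionPair x) Q ⇔ Adj H x (member r)) (proj₂ (realized r)) (⇔.sym (adj⇔meets x≢member))
      where
      x≢member : x ≢ member r
      x≢member refl = x∉W (∈-image⁺ r)

    TracesSeparate : Set
    TracesSeparate = ∀ {x y} → x ∉ W → y ∉ W →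
      (∀ r → Meets (positionPair x) (basis r) ⇔ Meets (positionPair y) (basis r)) → positionPair x ≡ positionPair y

    W-resolving : TracesSeparate → Resolving H W
    W-resolving separate = resolving-bySeparatingNeighbourhoods H W λ x∉W y∉W sameAdj →
      positionPair-injective (separate x∉W y∉W λ r →
        ⇔.trans (meetsBasis⇔adj x∉W r) (⇔.trans (≡⇒⇔ (sameAdj (∈-image⁺ r))) (⇔.sym (meetsBasis⇔adj y∉W r))))
      where
      ≡⇒⇔ : ∀ {a b : Bool} → a ≡ b → (a ≡ true) ⇔ (b ≡ true)
      ≡⇒⇔ a≡b = mk⇔ (trans (sym a≡b)) (trans a≡b)

  resolving-pathBasis : 5 ≤ n → (n ≡ 5 → ¬ Realized (1 , 3)) → ∃[ W ] (Resolving H W × ∣ W ∣ ≤ n ∸ 2)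
  resolving-pathBasis 5≤n noException = W , W-resolving tracesSeparate , ∣W∣≤K
    where
    open PairBasis (pathPair ∘ toℕ) (λ r → pathPair-realized (toℕ r) (≤-trans (n≤1+n _) (k<n∸2⇒3+k≤n (toℕ<n r))))
    open PathTraces 5≤n
    notPathPair : ∀ {x} → x ∉ W → ¬ IsPathPair n (positionPair x)
    notPathPair x∉W (j≡1+i , 3+i≤n) = ∉W⇒∉basis x∉W (fromℕ< (2+k≤n⇒k≤n∸2 3+i≤n))
      (cong₂ _,_ (toℕ-fromℕ< _) (trans (cong suc (toℕ-fromℕ< _)) (sym j≡1+i)))
    notExceptional : ∀ {x y} → ¬ Exceptional n (positionPair x) (positionPair y)
    notExceptional {y = y} (n≡5 , _ , y≡13) = noException n≡5 (y , y≡13)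
    tracesSeparate : TracesSeparate
    tracesSeparate {x} {y} x∉W y∉W same =
      pathTrace-injective (positionPair-sortedBelow _) (positionPair-sortedBelow _) (notPathPair x∉W) (notPathPair y∉W)
        notExceptional notExceptional λ k 3+k≤n →
          subst (λ Q → Meets (positionPair x) Q ⇔ Meets (positionPair y) Q) (cong pathPair (toℕ-fromℕ< _))
            (same (fromℕ< (2+k≤n⇒k≤n∸2 3+k≤n)))

  resolving-exceptionalBasis : n ≡ 5 → Realized (1 , 3) → ∃[ W ] (Resolving H W × ∣ W ∣ ≤ n ∸ 2)
  resolving-exceptionalBasis n≡5 realized₁₃ =
    W , W-resolving tracesSeparate , subst (λ n → ∣ W ∣ ≤ n ∸ 2) (sym n≡5) ∣W∣≤K
    where
    realized : ∀ r → Realized (exceptionalBasis r)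
    realized zero             = pathPair-realized 0 (subst (1 <_) (sym n≡5) (s≤s (s≤s z≤n)))
    realized (suc zero)       = pathPair-realized 1 (subst (2 <_) (sym n≡5) (s≤s (s≤s (s≤s z≤n))))
    realized (suc (suc zero)) = realized₁₃
    open PairBasis exceptionalBasis realized
    sortedBelow5 : ∀ x → SortedBelow 5 (positionPair x)
    sortedBelow5 x = subst (λ n → SortedBelow n (positionPair x)) n≡5 (positionPair-sortedBelow x)
    tracesSeparate : TracesSeparate
    tracesSeparate x∉W y∉W =
      exceptionalTrace-injective (sortedBelow5 _) (sortedBelow5 _) (∉W⇒∉basis x∉W) (∉W⇒∉basis y∉W)

  resolvingSet : 5 ≤ n → ∃[ W ] (Resolving H W × ∣ W ∣ ≤ n ∸ 2)
  resolvingSet 5≤n with n ≟ 5 | realized? (1 , 3)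
  ... | yes n≡5 | yes realized₁₃ = resolving-exceptionalBasis n≡5 realized₁₃
  ... | yes _   | no ¬realized₁₃ = resolving-pathBasis 5≤n λ _ → ¬realized₁₃
  ... | no n≢5  | _              = resolving-pathBasis 5≤n λ n≡5 → contradiction n≡5 n≢5

proposition4p3 : ∀ (n : ℕ) (G : Graph n) → 5 ≤ n → Connected G → HasHamiltonianPath G
    → ∀ (m : ℕ) (H : Graph m) → IsLineGraph G H → 2 * (n ∸ 2) ≤ m
    → ∀ (d z : ℕ) → IsMetricDimension H d → IsZeroForcingNumber H z → d ≤ z
proposition4p3 n G 5≤n _ (p , p-injective , p-path) m H L 2[n∸2]≤m d z
  (_ , dim-minimal) ((S , S-forcing , ∣S∣≡z) , _)
  with W , W-resolving , ∣W∣≤n∸2 ← HamiltonianPositions.resolvingSet L p p-injective p-path 5≤n = begin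
    d      ≤⟨ dim-minimal W W-resolving ⟩
    ∣ W ∣  ≤⟨ ∣W∣≤n∸2 ⟩
    n ∸ 2  ≤⟨ +-cancelʳ-≤ (n ∸ 2) (n ∸ 2) z (≤-trans 2[n∸2]≤m′ m≤z+[n∸2]) ⟩
    z      ∎
  where
  open ≤-Reasoning
  2[n∸2]≤m′ : n ∸ 2 + (n ∸ 2) ≤ m
  2[n∸2]≤m′ = subst (_≤ m) (cong (n ∸ 2 +_) (+-identityʳ (n ∸ 2))) 2[n∸2]≤m
  m≤z+[n∸2] : m ≤ z + (n ∸ 2)
  m≤z+[n∸2] = subst (λ s → m ≤ s + (n ∸ 2)) ∣S∣≡z
    (LineGraphForcing.∣zeroForcingSet∣-lowerBound L (≤-trans (n≤1+n 3) (≤-trans (n≤1+n 4) 5≤n)) S-forcing)
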